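{- Let $\langle W_\mu,\mu,\mathcal{F}^\mu\rangle$ be a gtf-frame and $M_2=\langle W_\tau,\tau,\mathcal{F}^\tau,V_\tau\rangle$ a gtf-model. Let $f:W_\mu\to W_\tau$ be $\mathcal{F}$-continuous and $\mathcal{F}$-open, and define $V_\mu(q)=f^{ -1}(V_\tau(q))$ for every $q\in PV$. Then (the graph of) $f$ is a generalized $1$-topo-bisimulation between $M_1=\langle W_\mu,\mu,\mathcal{F}^\mu,V_\mu\rangle$ and $M_2$.
   Context: A generalized topology on a nonempty set $W$ is a family $\mu\subseteq P(W)$ with $\emptyset\in\mu$ and closed under unions of arbitrary nonempty subfamilies; $\bigcup\mu$ is the union of its members. A gtf-frame is $\langle W,\mu,\mathcal{F}\rangle$ where $\mu$ is a generalized topology on $W$ and $\mathcal{F}:W\to P(P(\bigcup\mu))$ satisfies: if $w\in\bigcup\mu$ then $X\in\mathcal{F}_w$ iff ($X\in\mu$ and $w\in X$); if $w\notin\bigcup\mu$ then $\mathcal{F}_w\subseteq\mu$. A gtf-model adds a valuation $V:PV\to P(W)$, $PV$ a countable set of propositional variables. $f:W_\mu\to W_\tau$ is $\mathcal{F}$-continuous if for all $w\in W_\mu$ and every $G'\in\mathcal{F}^\tau_{f(w)}$, $f^{ -1}(G')\in\mathcal{F}^\mu_w$; it is $\mathcal{F}$-open if for all $w\in W_\mu$ and every $G\in\mathcal{F}^\mu_w$, $f(G)\in\mathcal{F}^\tau_{f(w)}$. A generalized $1$-topo-bisimulation between gtf-models $\langle W_\mu,\mu,\mathcal{F}^\mu,V_\mu\rangle$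 and $\langle W_\tau,\tau,\mathcal{F}^\tau,V_\tau\rangle$ is a nonempty relation $T\subseteq W_\mu\times W_\tau$ such that whenever $wTw'$: (1) for every $q\in PV$, $w\in V_\mu(q)$ iff $w'\in V_\tau(q)$; (2) if $O\in\mu$, $O\neq\emptyset$ and $O\in\mathcal{F}^\mu_w$, then there is $O'\in\mathcal{F}^\tau_{w'}$ such that for each $v'\in O'$ there is $v\in O$ with $vTv'$; (3) if $O'\in\tau$, $O'\neq\emptyset$ and $O'\in\mathcal{F}^\tau_{w'}$, then there is $O\in\mathcal{F}^\mu_w$ such that for each $v\in O$ there is $v'\in O'$ with $vTv'$. -}

module Defs where

open import Data.Nat using (ℕ)
open import Data.Empty using (⊥)
open import Data.Product using (Σ; _×_; ∃)
open import Relation.Nullary using (¬_)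
open import Relation.Binary.PropositionalEquality using (_≡_)
open import Level using (Level; suc; zero)

Subset : Set → Set₁
Subset W = W → Set

_⊆_ : {W : Set} → Subset W → Subset W → Set
A ⊆ B = ∀ {x} → A x → B x

PV : Set
PV = ℕ

-- generalized topology: contains ∅, closed under unions of nonempty (indexed) subfamilies
record IsGenTop (W : Set) (μ : Subset W → Set) : Set₁ where
  field
    empty∈ : μ (λ _ → ⊥)
    union∈ : (I : Set) → I → (U : I → Subset W) → (∀ i → μ (U i)) →
             μ (λ w → Σ I (λ i → U i w))

⋃ : {W : Set} → (Subset W → Set) → W → Set₁
⋃ {W} μ w = Σ (Subset W) (λ X → μ X × X w)

record GTFrame : Set₂ where
  field
    W     : Set
    point : W
    μ     : Subset W → Set
    isGT  : IsGenTop W μ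
    F     : W → Subset W → Set
    F⊆⋃   : ∀ w X → F w X → ∀ {v} → X v → ⋃ μ v
    F-in⇒ : ∀ w → ⋃ μ w → ∀ X → F w X → μ X × X w
    F-in⇐ : ∀ w → ⋃ μ w → ∀ X → μ X × X w → F w X
    F-out : ∀ w → ¬ ⋃ μ w → ∀ X → F w X → μ X

record GTModel : Set₂ where
  field
    frame : GTFrame
  open GTFrame frame public
  field
    V : PV → Subset W

preimage : {A B : Set} → (A → B) → Subset B → Subset A
preimage f G x = G (f x)

image : {A B : Set} → (A → B) → Subset A → Subset B
image f G y = ∃ (λ x → G x × f x ≡ y)

module _ (M₁ M₂ : GTFrame) where
  private
    module A = GTFrame M₁
    module B = GTFrame M₂

  F-continuous : (A.W → B.W) → Set₁
  F-continuous f = ∀ w (G' : Subset B.W) → B.F (f w) G' → A.F w (preimage f G')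

  F-open : (A.W → B.W) → Set₁
  F-open f = ∀ w (G : Subset A.W) → A.F w G → B.F (f w) (image f G)

mkModel : (M : GTFrame) → (PV → Subset (GTFrame.W M)) → GTModel
mkModel M V = record { frame = M ; V = V }

module _ (M₁ M₂ : GTModel) where
  private
    module A = GTModel M₁
    module B = GTModel M₂

  record IsGen1TopoBisim (T : A.W → B.W → Set) : Set₁ where
    field
      nonempty : Σ A.W (λ w → Σ B.W (λ w' → T w w'))
      atoms    : ∀ {w w'} → T w w' → ∀ (q : PV) → (A.V q w → B.V q w') × (B.V q w' → A.V q w)
      forth    : ∀ {w w'} → T w w' → ∀ (O : Subset A.W) → A.μ O → ¬ (∀ v → ¬ O v) → A.F w O →
                 Σ (Subset B.W) (λ O' → B.F w' O' × (∀ v' → O' v' → Σ A.W (λ v → O v × T v v')))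
      back     : ∀ {w w'} → T w w' → ∀ (O' : Subset B.W) → B.μ O' → ¬ (∀ v' → ¬ O' v') → B.F w' O' →
                 Σ (Subset A.W) (λ O → A.F w O × (∀ v → O v → Σ B.W (λ v' → O' v' × T v v')))

graph : {A B : Set} → (A → B) → A → B → Set
graph f w w' = f w ≡ w'

module Submission where

open import Defs
open import Data.Product using (Σ; _×_; _,_)
open import Function using (id)
open import Relation.Binary.PropositionalEquality using (_≡_; refl)

-- The forth and back conditions hold without their nonemptiness and openness
-- hypotheses: the image f(O) and the preimage f⁻¹(O') are the required witnesses.

module _ (M₁ M₂ : GTModel) (f : GTModel.W M₁ → GTModel.W M₂) where
  private
    module A = GTModel M₁
    module B = GTModel M₂

  graph-atoms : (∀ q w → A.V q w ≡ B.V q (f w)) →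
                ∀ {w w'} → graph f w w' → ∀ q → (A.V q w → B.V q w') × (B.V q w' → A.V q w)
  graph-atoms V≡ {w} refl q rewrite V≡ q w = id , id

  image-covered-by-graph : ∀ (O : Subset A.W) v' → image f O v' →
                           Σ A.W (λ v → O v × graph f v v')
  image-covered-by-graph O v' (v , Ov , fv≡v') = v , Ov , fv≡v'

  preimage-covered-by-graph : ∀ (O' : Subset B.W) v → preimage f O' v →
                              Σ B.W (λ v' → O' v' × graph f v v')
  preimage-covered-by-graph O' v O'fv = f v , O'fv , refl

  graph-forth : F-open A.frame B.frame f →
                ∀ {w w'} → graph f w w' → ∀ (O : Subset A.W) → A.F w O →
                Σ (Subset B.W) (λ O' → B.F w' O' × (∀ v' → O' v' → Σ A.W (λ v → O v × graph f v v')))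
  graph-forth open-f {w} refl O FO = image f O , open-f w O FO , image-covered-by-graph O

  graph-back : F-continuous A.frame B.frame f →
               ∀ {w w'} → graph f w w' → ∀ (O' : Subset B.W) → B.F w' O' →
               Σ (Subset A.W) (λ O → A.F w O × (∀ v → O v → Σ B.W (λ v' → O' v' × graph f v v')))
  graph-back cont-f {w} refl O' FO' = preimage f O' , cont-f w O' FO' , preimage-covered-by-graph O'

  graph-isGen1TopoBisim : (∀ q w → A.V q w ≡ B.V q (f w)) →
                          F-continuous A.frame B.frame f → F-open A.frame B.frame f →
                          IsGen1TopoBisim M₁ M₂ (graph f)
  graph-isGen1TopoBisim V≡ cont-f open-f = record
    { nonempty = A.point , f A.point , refl
    ; atoms    = graph-atoms V≡
    ; forth    = λ wTw' O _ _ → graph-forth open-f wTw' O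
    ; back     = λ wTw' O' _ _ → graph-back cont-f wTw' O'
    }

mainTheorem8 : (M₁ : GTFrame) (M₂ : GTModel) (f : GTFrame.W M₁ → GTModel.W M₂) →
    F-continuous M₁ (GTModel.frame M₂) f → F-open M₁ (GTModel.frame M₂) f →
    IsGen1TopoBisim (mkModel M₁ (λ q → preimage f (GTModel.V M₂ q))) M₂ (graph f)
mainTheorem8 M₁ M₂ f =
  graph-isGen1TopoBisim (mkModel M₁ (λ q → preimage f (GTModel.V M₂ q))) M₂ f (λ _ _ → refl)
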